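{- Let $G = Z_{44}\times Z_{353}$ with multiplication $[x,y][u,v] = [x+u \bmod 44,\; y\cdot 207^{u} + v \bmod 353]$ (a group of order $15532$). Let $S=\{g,g^{ -1} : g\in\{[25,50],[43,41],[22,0]\}\}$. Then $S$ consists of exactly $5$ non-identity elements and the Cayley graph $\mathrm{Cay}(G,S)$ is a connected $5$-regular graph of diameter $8$ on $15532$ vertices.
   Context: For a finite group $G$ and an inverse-closed subset $S\subseteq G$ not containing the identity, the Cayley graph $\mathrm{Cay}(G,S)$ is the undirected graph with vertex set $G$ in which $x$ and $y$ are adjacent iff $y=xs$ for some $s\in S$; it is $|S|$-regular. The diameter of a connected graph is the maximum over all pairs of vertices of the length of a shortest path between them. For integers $m,n$ and a unit $a$ of $Z_n$ whose multiplicative order divides $m$, the group $m\times_a n$ is the set $Z_m\times Z_n$ with multiplication $[x,y][u,v]=[x+u \bmod m,\; y a^u+v \bmod n]$. -}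

module Defs where

open import Data.Nat using (ℕ; zero; suc; _+_; _*_; _^_; _≤_)
open import Data.Nat.DivMod using (_mod_)
open import Data.Fin using (Fin; toℕ)
open import Data.Product using (_×_; _,_; ∃; Σ)
open import Data.Sum using (_⊎_)
open import Data.List using (List; []; _∷_; length)
open import Data.List.Membership.Propositional using (_∈_)
open import Data.List.Relation.Unary.Unique.Propositional using (Unique)
open import Relation.Binary.PropositionalEquality using (_≡_)

G : Set
G = Fin 44 × Fin 353

_·_ : G → G → G
(x , y) · (u , v) = ((toℕ x + toℕ u) mod 44 , (toℕ y * 207 ^ toℕ u + toℕ v) mod 353)

e : G
e = (0 mod 44 , 0 mod 353)

mk : ℕ → ℕ → G
mk x y = (x mod 44 , y mod 353)

gens : List G
gens = mk 25 50 ∷ mk 43 41 ∷ mk 22 0 ∷ []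

S : G → Set
S s = ∃ λ g → g ∈ gens × (s ≡ g ⊎ g · s ≡ e)

HasExactly : ℕ → (G → Set) → Set
HasExactly n P = Σ (List G) λ l →
  length l ≡ n × Unique l × (∀ z → z ∈ l → P z) × (∀ z → P z → z ∈ l)

Adj : G → G → Set
Adj x y = ∃ λ s → S s × y ≡ x · s

data Walk : G → G → ℕ → Set where
  here : ∀ {x} → Walk x x 0
  step : ∀ {x y z k} → Adj x y → Walk y z k → Walk x z (suc k)

Connected : Set
Connected = ∀ x y → ∃ λ k → Walk x y k

Regular : ℕ → Set
Regular k = ∀ x → HasExactly k (Adj x)

HasDiameter : ℕ → Set
HasDiameter d =
  (∀ x y → ∃ λ k → k ≤ d × Walk x y k) ×
  (∃ λ x → ∃ λ y → ∀ k → Walk x y k → d ≤ k)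

-- Left multiplication by g maps walks to walks, so the distance from x to y in the Cayley graph
-- is the distance from y⁻¹x to the identity. A table of labels dist : G → ℕ, found by
-- breadth-first search, is checked at every vertex against two local conditions: a vertex other
-- than e has a neighbour labelled one less, and labels grow by at most one along an edge. By the
-- first, dist a is the length of a walk from a to e; by the second, no walk from e to a is shorter.
-- All labels are at most 8 and the label of [16 , 326] is 8. Regularity is left cancellation in G.

module Submission where

open import Defs
open import Data.Product using (_×_; _,_; proj₁; proj₂; ∃; uncurry)
open import Relation.Nullary using (¬_; Dec)
open import Data.Unit using (⊤; tt)
open import Relation.Binary.PropositionalEquality using (_≡_; refl; sym; trans; cong; cong₂; subst; subst₂; module ≡-Reasoning)

open import Level using (0ℓ)
open import Function using (_∘_)
open import Algebra.Bundles using (Monoid; Group)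
open import Algebra.Core using (Op₁)
open import Algebra.Structures {A = G} _≡_ using (IsMonoid; IsGroup)
open import Data.Empty using (⊥-elim)
open import Data.Sum using (_⊎_; inj₁; inj₂)
open import Data.Product.Properties using (≡-dec)
open import Data.Nat using (ℕ; zero; suc; _+_; _*_; _^_; _∸_; _≤_; _<_; NonZero; _≤?_)
open import Data.Nat.Properties using (_≟_; allUpTo?; m^n≢0; ^-distribˡ-+-*; m+[n∸m]≡n; <⇒≤; +-identityʳ; *-identityʳ; *-identityˡ; +-assoc; +-suc; m≤m+n; +-monoˡ-≤; suc-injective; 1+n≢0; +-commutativeSemigroup; module ≤-Reasoning)
open import Data.Nat.DivMod using (_%_; _/_; %-distribˡ-+; %-distribˡ-*; m%n%n≡m%n; n%n≡0; m<n⇒m%n≡m; m%n≤n; m%n<n; m≡m%n+[m/n]*n)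
open import Data.Nat.Solver using (module +-*-Solver)
open import Algebra.Properties.CommutativeSemigroup +-commutativeSemigroup using (x∙yz≈y∙xz)
open import Data.Fin using (toℕ)
open import Data.Fin.Properties using (toℕ-injective; toℕ-fromℕ<; toℕ<n) renaming (_≟_ to _≟ᶠ_)
open import Data.List using (List; []; _∷_; map; cartesianProduct; allFin)
open import Data.List.Properties using (length-map)
open import Data.List.Relation.Unary.All using (All; all?)
import Data.List.Relation.Unary.All as All
open import Data.List.Relation.Unary.Any using (Any; here; there; any?)
open import Data.List.Relation.Unary.Any.Properties using (map⁻)
open import Data.List.Membership.Propositional using (_∈_; find)
open import Data.List.Membership.Propositional.Properties using (∈-map⁺; ∈-map⁻; ∈-cartesianProduct⁺; ∈-allFin)
open import Data.List.Relation.Unary.Unique.Propositional.Properties using (map⁺; cartesianProduct⁺; allFin⁺)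
open import Relation.Nullary.Decidable using (from-yes; from-no; _⊎-dec_)
open import Relation.Unary using (Decidable)
open import Relation.Binary.PropositionalEquality.Algebra using (isMagma)

module _ {c ℓ} (M : Monoid c ℓ) (_⁻¹ : Op₁ (Monoid.Carrier M)) where
  open Monoid M
  open import Algebra.Definitions _≈_ using (LeftInverse; RightInverse)
  open import Relation.Binary.Reasoning.Setoid setoid

  rightInverse⇒leftInverse : RightInverse ε _⁻¹ _∙_ → LeftInverse ε _⁻¹ _∙_
  rightInverse⇒leftInverse invʳ x = begin
    x ⁻¹ ∙ x                           ≈⟨ identityʳ (x ⁻¹ ∙ x) ⟨
    x ⁻¹ ∙ x ∙ ε                       ≈⟨ ∙-congˡ (invʳ (x ⁻¹)) ⟨
    x ⁻¹ ∙ x ∙ (x ⁻¹ ∙ (x ⁻¹) ⁻¹)      ≈⟨ assoc (x ⁻¹) x _ ⟩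
    x ⁻¹ ∙ (x ∙ (x ⁻¹ ∙ (x ⁻¹) ⁻¹))    ≈⟨ ∙-congˡ (assoc x (x ⁻¹) _) ⟨
    x ⁻¹ ∙ (x ∙ x ⁻¹ ∙ (x ⁻¹) ⁻¹)      ≈⟨ ∙-congˡ (∙-congʳ (invʳ x)) ⟩
    x ⁻¹ ∙ (ε ∙ (x ⁻¹) ⁻¹)             ≈⟨ ∙-congˡ (identityˡ _) ⟩
    x ⁻¹ ∙ (x ⁻¹) ⁻¹                   ≈⟨ invʳ (x ⁻¹) ⟩
    ε                                  ∎

module _ {d : ℕ} .{{_ : NonZero d}} where

  +-cong-mod : ∀ {a a′ b b′} → a % d ≡ a′ % d → b % d ≡ b′ % d → (a + b) % d ≡ (a′ + b′) % d
  +-cong-mod {a} {a′} {b} {b′} a≡a′ b≡b′ = begin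
    (a + b) % d              ≡⟨ %-distribˡ-+ a b d ⟩
    (a % d + b % d) % d      ≡⟨ cong₂ (λ s t → (s + t) % d) a≡a′ b≡b′ ⟩
    (a′ % d + b′ % d) % d    ≡⟨ %-distribˡ-+ a′ b′ d ⟨
    (a′ + b′) % d            ∎
    where open ≡-Reasoning

  *-cong-mod : ∀ {a a′ b b′} → a % d ≡ a′ % d → b % d ≡ b′ % d → (a * b) % d ≡ (a′ * b′) % d
  *-cong-mod {a} {a′} {b} {b′} a≡a′ b≡b′ = begin
    (a * b) % d              ≡⟨ %-distribˡ-* a b d ⟩
    (a % d * (b % d)) % d    ≡⟨ cong₂ (λ s t → (s * t) % d) a≡a′ b≡b′ ⟩
    (a′ % d * (b′ % d)) % d  ≡⟨ %-distribˡ-* a′ b′ d ⟨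
    (a′ * b′) % d            ∎
    where open ≡-Reasoning

module SemidirectProduct (m n a : ℕ) .{{_ : NonZero m}} .{{_ : NonZero n}} where

  infixl 7 _∙_
  _∙_ : ℕ × ℕ → ℕ × ℕ → ℕ × ℕ
  (x , y) ∙ (u , v) = ((x + u) % m , (y * a ^ u + v) % n)

  inverse : ℕ × ℕ → ℕ × ℕ
  inverse (x , y) = (x⁻ , (n ∸ (y * a ^ x⁻) % n) % n)
    where x⁻ = (m ∸ x) % m

  ∙-identityˡ : ∀ {x y} → x < m → y < n → (0 , 0) ∙ (x , y) ≡ (x , y)
  ∙-identityˡ x<m y<n = cong₂ _,_ (m<n⇒m%n≡m x<m) (m<n⇒m%n≡m y<n)

  ∙-identityʳ : ∀ {x y} → x < m → y < n → (x , y) ∙ (0 , 0) ≡ (x , y)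
  ∙-identityʳ {x} {y} x<m y<n = cong₂ _,_
    (trans (cong (_% m) (+-identityʳ x)) (m<n⇒m%n≡m x<m))
    (trans (cong (_% n) (trans (+-identityʳ (y * 1)) (*-identityʳ y))) (m<n⇒m%n≡m y<n))

  ∙-inverseʳ : ∀ {x y} → x ≤ m → (x , y) ∙ inverse (x , y) ≡ (0 , 0)
  ∙-inverseʳ {x} {y} x≤m = cong₂ _,_ first second
    where
    open ≡-Reasoning
    first : (x + (m ∸ x) % m) % m ≡ 0
    first = begin
      (x + (m ∸ x) % m) % m      ≡⟨ +-cong-mod refl (m%n%n≡m%n (m ∸ x) m) ⟩
      (x + (m ∸ x)) % m          ≡⟨ cong (_% m) (m+[n∸m]≡n x≤m) ⟩
      m % m                      ≡⟨ n%n≡0 m ⟩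
      0                          ∎
    Y = y * a ^ ((m ∸ x) % m)
    second : (Y + (n ∸ Y % n) % n) % n ≡ 0
    second = begin
      (Y + (n ∸ Y % n) % n) % n  ≡⟨ +-cong-mod (sym (m%n%n≡m%n Y n)) (m%n%n≡m%n _ n) ⟩
      (Y % n + (n ∸ Y % n)) % n  ≡⟨ cong (_% n) (m+[n∸m]≡n (m%n≤n Y n)) ⟩
      n % n                      ≡⟨ n%n≡0 n ⟩
      0                          ∎

  module _ (a^m≡1 : a ^ m % n ≡ 1 % n) where

    ^-%-periodic : ∀ k r → a ^ (r + k * m) % n ≡ a ^ r % n
    ^-%-periodic zero    r = cong (λ t → a ^ t % n) (+-identityʳ r)
    ^-%-periodic (suc k) r = begin
      a ^ (r + (m + k * m)) % n    ≡⟨ cong (λ t → a ^ t % n) (x∙yz≈y∙xz r m (k * m)) ⟩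
      a ^ (m + (r + k * m)) % n    ≡⟨ cong (_% n) (^-distribˡ-+-* a m (r + k * m)) ⟩
      a ^ m * a ^ (r + k * m) % n  ≡⟨ *-cong-mod a^m≡1 refl ⟩
      1 * a ^ (r + k * m) % n      ≡⟨ cong (_% n) (*-identityˡ _) ⟩
      a ^ (r + k * m) % n          ≡⟨ ^-%-periodic k r ⟩
      a ^ r % n                    ∎
      where open ≡-Reasoning

    ^-%-reduce : ∀ t → a ^ t % n ≡ a ^ (t % m) % n
    ^-%-reduce t = trans (cong (λ s → a ^ s % n) (m≡m%n+[m/n]*n t m)) (^-%-periodic (t / m) (t % m))

    ∙-assoc : ∀ p q r → (p ∙ q) ∙ r ≡ p ∙ (q ∙ r)
    ∙-assoc (x , y) (u , v) (w , z) = cong₂ _,_ first second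
      where
      open ≡-Reasoning
      open +-*-Solver using (solve; _:+_; _:*_; _:=_)
      first : ((x + u) % m + w) % m ≡ (x + (u + w) % m) % m
      first = begin
        ((x + u) % m + w) % m  ≡⟨ +-cong-mod (m%n%n≡m%n (x + u) m) refl ⟩
        (x + u + w) % m        ≡⟨ cong (_% m) (+-assoc x u w) ⟩
        (x + (u + w)) % m      ≡⟨ +-cong-mod refl (m%n%n≡m%n (u + w) m) ⟨
        (x + (u + w) % m) % m  ∎
      A = a ^ u
      B = a ^ w
      second : ((y * A + v) % n * B + z) % n ≡ (y * a ^ ((u + w) % m) + (v * B + z) % n) % n
      second = begin
        ((y * A + v) % n * B + z) % n
          ≡⟨ +-cong-mod (*-cong-mod (m%n%n≡m%n (y * A + v) n) refl) refl ⟩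
        ((y * A + v) * B + z) % n
          ≡⟨ cong (_% n) (solve 5 (λ y A v B z → (y :* A :+ v) :* B :+ z := y :* (A :* B) :+ (v :* B :+ z)) refl y A v B z) ⟩
        (y * (A * B) + (v * B + z)) % n
          ≡⟨ cong (λ t → (y * t + (v * B + z)) % n) (^-distribˡ-+-* a u w) ⟨
        (y * a ^ (u + w) + (v * B + z)) % n
          ≡⟨ +-cong-mod (*-cong-mod {a = y} refl (^-%-reduce (u + w))) (sym (m%n%n≡m%n _ n)) ⟩
        (y * a ^ ((u + w) % m) + (v * B + z) % n) % n
          ∎

open SemidirectProduct 44 353 207

toℕ² : G → ℕ × ℕ
toℕ² (x , y) = (toℕ x , toℕ y)

toℕ²-injective : ∀ {p q} → toℕ² p ≡ toℕ² q → p ≡ q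
toℕ²-injective {_ , _} {_ , _} eq = cong₂ _,_ (toℕ-injective (cong proj₁ eq)) (toℕ-injective (cong proj₂ eq))

toℕ²-mk : ∀ i j → toℕ² (mk i j) ≡ (i % 44 , j % 353)
toℕ²-mk i j = cong₂ _,_ (toℕ-fromℕ< _) (toℕ-fromℕ< _)

toℕ²-mk-< : ∀ {i j} → i < 44 → j < 353 → toℕ² (mk i j) ≡ (i , j)
toℕ²-mk-< {i} {j} i<44 j<353 = trans (toℕ²-mk i j) (cong₂ _,_ (m<n⇒m%n≡m i<44) (m<n⇒m%n≡m j<353))

toℕ²-· : ∀ p q → toℕ² (p · q) ≡ toℕ² p ∙ toℕ² q
toℕ²-· (x , y) (u , v) = toℕ²-mk (toℕ x + toℕ u) (toℕ y * 207 ^ toℕ u + toℕ v)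

infix 30 _⁻¹
_⁻¹ : G → G
p ⁻¹ = uncurry mk (inverse (toℕ² p))

toℕ²-⁻¹ : ∀ p → toℕ² (p ⁻¹) ≡ inverse (toℕ² p)
toℕ²-⁻¹ (x , y) = toℕ²-mk-< (m%n<n (44 ∸ toℕ x) 44) (m%n<n (353 ∸ (toℕ y * 207 ^ ((44 ∸ toℕ x) % 44)) % 353) 353)

·-assoc : ∀ p q r → (p · q) · r ≡ p · (q · r)
·-assoc p q r = toℕ²-injective (begin
  toℕ² ((p · q) · r)          ≡⟨ toℕ²-· (p · q) r ⟩
  toℕ² (p · q) ∙ toℕ² r       ≡⟨ cong (_∙ toℕ² r) (toℕ²-· p q) ⟩
  toℕ² p ∙ toℕ² q ∙ toℕ² r    ≡⟨ ∙-assoc refl (toℕ² p) (toℕ² q) (toℕ² r) ⟩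
  toℕ² p ∙ (toℕ² q ∙ toℕ² r)  ≡⟨ cong (toℕ² p ∙_) (toℕ²-· q r) ⟨
  toℕ² p ∙ toℕ² (q · r)       ≡⟨ toℕ²-· p (q · r) ⟨
  toℕ² (p · (q · r))          ∎)
  where open ≡-Reasoning

·-identityˡ : ∀ p → e · p ≡ p
·-identityˡ p@(x , y) = toℕ²-injective (trans (toℕ²-· e p) (∙-identityˡ (toℕ<n x) (toℕ<n y)))

·-identityʳ : ∀ p → p · e ≡ p
·-identityʳ p@(x , y) = toℕ²-injective (trans (toℕ²-· p e) (∙-identityʳ (toℕ<n x) (toℕ<n y)))

·-inverseʳ : ∀ p → p · p ⁻¹ ≡ e
·-inverseʳ p@(x , y) = toℕ²-injective (begin
  toℕ² (p · p ⁻¹)            ≡⟨ toℕ²-· p (p ⁻¹) ⟩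
  toℕ² p ∙ toℕ² (p ⁻¹)       ≡⟨ cong (toℕ² p ∙_) (toℕ²-⁻¹ p) ⟩
  toℕ² p ∙ inverse (toℕ² p)  ≡⟨ ∙-inverseʳ {y = toℕ y} (<⇒≤ (toℕ<n x)) ⟩
  toℕ² e                     ∎)
  where open ≡-Reasoning

·-isMonoid : IsMonoid _·_ e
·-isMonoid = record
  { isSemigroup = record { isMagma = isMagma _·_ ; assoc = ·-assoc }
  ; identity    = ·-identityˡ , ·-identityʳ
  }

·-isGroup : IsGroup _·_ e _⁻¹
·-isGroup = record
  { isMonoid = ·-isMonoid
  ; inverse  = rightInverse⇒leftInverse (record { isMonoid = ·-isMonoid }) _⁻¹ ·-inverseʳ , ·-inverseʳ
  ; ⁻¹-cong  = cong _⁻¹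
  }

group : Group 0ℓ 0ℓ
group = record { isGroup = ·-isGroup }

open Group group using (_\\_)
open import Algebra.Properties.Group group using (∙-cancelˡ; inverseʳ-unique; \\-leftDividesˡ)

_≟ᴳ_ : (p q : G) → Dec (p ≡ q)
_≟ᴳ_ = ≡-dec _≟ᶠ_ _≟ᶠ_

open import Data.List.Membership.DecPropositional _≟ᴳ_ using (_∈?_)
open import Data.List.Relation.Unary.Unique.DecPropositional _≟ᴳ_ using (unique?)

g₁ g₂ g₃ : G
g₁ = mk 25 50
g₂ = mk 43 41
g₃ = mk 22 0

g₃-involution : g₃ ⁻¹ ≡ g₃
g₃-involution = refl

Sᴸ : List G
Sᴸ = g₁ ∷ g₁ ⁻¹ ∷ g₂ ∷ g₂ ⁻¹ ∷ g₃ ∷ []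

∈Sᴸ⇒S : ∀ {s} → s ∈ Sᴸ → S s
∈Sᴸ⇒S (here refl)                                 = g₁ , here refl , inj₁ refl
∈Sᴸ⇒S (there (here refl))                         = g₁ , here refl , inj₂ (·-inverseʳ g₁)
∈Sᴸ⇒S (there (there (here refl)))                 = g₂ , there (here refl) , inj₁ refl
∈Sᴸ⇒S (there (there (there (here refl))))         = g₂ , there (here refl) , inj₂ (·-inverseʳ g₂)
∈Sᴸ⇒S (there (there (there (there (here refl))))) = g₃ , there (there (here refl)) , inj₁ refl

S⇒∈Sᴸ : ∀ {s} → S s → s ∈ Sᴸ
S⇒∈Sᴸ (_ , here refl , inj₁ refl)                  = here refl
S⇒∈Sᴸ (_ , here refl , inj₂ g₁s≡e)                 = there (here (inverseʳ-unique g₁ _ g₁s≡e))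
S⇒∈Sᴸ (_ , there (here refl) , inj₁ refl)          = there (there (here refl))
S⇒∈Sᴸ (_ , there (here refl) , inj₂ g₂s≡e)         = there (there (there (here (inverseʳ-unique g₂ _ g₂s≡e))))
S⇒∈Sᴸ (_ , there (there (here refl)) , inj₁ refl)  = there (there (there (there (here refl))))
S⇒∈Sᴸ (_ , there (there (here refl)) , inj₂ g₃s≡e) =
  there (there (there (there (here (trans (inverseʳ-unique g₃ _ g₃s≡e) g₃-involution)))))

S-has-5 : HasExactly 5 S
S-has-5 = Sᴸ , refl , from-yes (unique? Sᴸ) , (λ _ → ∈Sᴸ⇒S) , (λ _ → S⇒∈Sᴸ)

e∉S : ∀ s → S s → ¬ (s ≡ e)
e∉S s s∈S refl = from-no (e ∈? Sᴸ) (S⇒∈Sᴸ s∈S)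

G-has-15532 : HasExactly 15532 (λ _ → ⊤)
G-has-15532 =
  cartesianProduct (allFin 44) (allFin 353) , refl , cartesianProduct⁺ (allFin⁺ 44) (allFin⁺ 353) ,
  (λ _ _ → tt) , λ (x , y) _ → ∈-cartesianProduct⁺ (∈-allFin x) (∈-allFin y)

cayley-regular : ∀ {k} → HasExactly k S → Regular k
cayley-regular (l , |l|≡k , l-unique , l⊆S , S⊆l) x =
  map (x ·_) l , trans (length-map (x ·_) l) |l|≡k , map⁺ (∙-cancelˡ x _ _) l-unique ,
  (λ y y∈xl → let s , s∈l , y≡xs = ∈-map⁻ (x ·_) y∈xl in s , l⊆S s s∈l , y≡xs) ,
  λ { _ (s , s∈S , refl) → ∈-map⁺ (x ·_) (S⊆l s s∈S) }

walk-lmul : ∀ g {a b k} → Walk a b k → Walk (g · a) (g · b) k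
walk-lmul g here                         = here
walk-lmul g (step (s , s∈S , refl) walk) = step (s , s∈S , sym (·-assoc g _ s)) (walk-lmul g walk)

module _ (f : G → ℕ) where

  EdgeLipschitz : Set
  EdgeLipschitz = ∀ a b → Adj a b → f b ≤ suc (f a)

  DescendsTo : G → Set
  DescendsTo r = ∀ a → a ≡ r ⊎ ∃ λ b → Adj a b × suc (f b) ≡ f a

  walk-length-≥ : EdgeLipschitz → ∀ {a b k} → Walk a b k → f b ≤ f a + k
  walk-length-≥ lip {a} here = m≤m+n (f a) 0
  walk-length-≥ lip {a} {b} (step {y = c} {k = k} a~c walk) = begin
    f b            ≤⟨ walk-length-≥ lip walk ⟩
    f c + k        ≤⟨ +-monoˡ-≤ k (lip a c a~c) ⟩
    suc (f a) + k  ≡⟨ +-suc (f a) k ⟨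
    f a + suc k    ∎
    where open ≤-Reasoning

  walk-to-root : ∀ {r} → f r ≡ 0 → DescendsTo r → ∀ a → Walk a r (f a)
  walk-to-root {r} fr≡0 descends a = go (f a) a refl
    where
    go : ∀ k a → f a ≡ k → Walk a r k
    go k a fa≡k with descends a
    ... | inj₁ refl = subst (Walk r r) (trans (sym fr≡0) fa≡k) here
    go zero    a fa≡0   | inj₂ (_ , _ , 1+fb≡fa)   = ⊥-elim (1+n≢0 (trans 1+fb≡fa fa≡0))
    go (suc k) a fa≡1+k | inj₂ (b , a~b , 1+fb≡fa) = step a~b (go k b (suc-injective (trans 1+fb≡fa fa≡1+k)))

  walk-between : f e ≡ 0 → DescendsTo e → ∀ x y → Walk x y (f (y \\ x))
  walk-between fe≡0 descends x y =
    subst₂ (λ u v → Walk u v (f (y \\ x))) (\\-leftDividesˡ y x) (·-identityʳ y)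
      (walk-lmul y (walk-to-root fe≡0 descends (y \\ x)))

-- Read from its least significant hexadecimal digit, row i lists the labels of [i , 0], [i , 1], …, [i , 352].
distanceRows : List ℕ
distanceRows =
  0x66586777686756786676657666786486655776777774764886676776887767887774565667676778446856767777777667648776767576866677576688777766668657877576677676586686656667777857686567787764467787765686758777766656686685676776675778756866667777886675776668675767677846766777777767658644877676766565477788767788677676688467477777677556684687666756676687657686777685660
  ∷ 0x76767567877467176687678776765686777766575676577764667766775675777677765776676776775656657777668555847777678677576557765777466776566487778677757678647778485676575676777665776778868787566677755377886664777647877757567777774765766766778767755657777887776767557766877776856777677776867568655777567757456586677777677566787777578367878776665773776777745777678
  ∷ 0x67777887665747766878557666737667778566677667654777575777455378877676667587557777576577476577766576666777877776577567666477886573667757767866677677885776677775768677766666766778675678666677767867765677586777776677666768657747367687776877786655687768678468777665775674775787656777677776566778683772677777777677767757687766747856868635667667667766777787766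
  ∷ 0x68477486567686676466577866877866677458677568876662777666676867786767886777667774877778777777667868666777767777777878764778687667666666577677767758477677786777877746587857687578876776776765766778767767786776677787574873666687766777867656777775756767767746766768577777877677676766877867757567768776667778275788786576676776457776747765664677767777674776667
  ∷ 0x77778777767767656768877767677758676676767366777777476575677566677756676765687757776565676756785773766587765675776678777677776683675666588767737877777677777777687767777567657777777776865778787767777576778777877637687876765577575777776786685877676757877668366777477784777677757776566657777766577877776676775658845766766677877777667768847456767667577778574
  ∷ 0x77767677577767577587778475677888365476777677767765776766577666775576775767886664857687776776867767687667767774776556688857848778767577767776776776877477567877667777776777776777777477787677777746776885874678686777687876775768677747866777457676577875767767767687676767666757467876677787776567756775677776767767756658756365778576676777673777777777676777667
  ∷ 0x57767757777867667787677766775876578776675667656677667566666787867776766577685767677787876876676678767687767767776475678674766784876676677827767886777677687666876866666666647668866756476677747657667776787877478567748776666667677666677777574877866776787877877677876687576766777776875867777668767666777787787756766677667887766587667777778656878777677865767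
  ∷ 0x67787667877767786756876687688676867585776767877666668676676677767675675777776777656887788857676786767587787777677775777776765777778786775767877757776737777875767377577777776787787777778775775667377777658675777668577686577678778675776778587676777776865777886776757877777657767677667788777776776777887757667776767688567757677776768678675687777776576777787
  ∷ 0x78878767867774667667676667877576777766777777685767677686886877886758768777877876677767776677766875676778777677777767877665768876775776577477876868587877867778888874777778765768867787787778676776677778778775848677776777777557877757567877776676676777777656578677776677768576767778778668777678777687677886778587677677676777574678877676847766677767678678887
  ∷ 0x86885868878777878678786878878757677786767688777667876687677886787777677647588868666676685667677684788688688677887856677686767688686768876786668677676687886868577667766766884688686486768876667777677687786676887877677776776676778777687778877786867886677768686786787777778666657777767877566777677786686878766877787877787566777878777877866676775778668778677
  ∷ 0x76777876777777688677667686767677867757878677678776777887886777887777788788757677767775588777778677675878778777878878777787776767777577757767775777577777877788867778755768775775557568677757877578877778777677876577677777777778787777788777778877777777777767657687767687578777758777887777877676678678778577777677876776757777766777878777877787877756677777677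
  ∷ 0x66877667687767768877677777778887675778875668777687676676667756657678777778777886777776868766776777777587777788787788875876677777668776867878876687776777887776776778776785676867776875788677667777776788875777776677876667666865878876687766787687887767776767877777668877777777688787867777776877777767676857785758867778886778878676777678556778766766877778878
  ∷ 0x67776888677878867676777476866477788878768777877778877886676788778777866677877788777877876767876878776677778778467787677788878776778777666764767877677767787766878787767786777676767786687767677876677776768867786777677787767778676777876666767766787668776678787487777677677767787788666688776787677776787686786777677787667687876876786887677876787776888667868
  ∷ 0x78777768787777887768787767677787677587775777775658776777767766787676668775788867755757767787777877778787576787777586857786777777587786777767865778676687776767777776786787767777776777787876787777578777778777777667777565678773658775676878676777767776777777777677877777777557688767778877867777667677677677876677785776777766777778777788877777757787875787777
  ∷ 0x78777778676878766858865668777685877655877657676877756688687768875577776768787877778676787788687677777877778876887777857788776767876786687674677886567886768858777787777577676678756766766876787888777777677665788777677767787678787677687676757876678775578687877887875785786877768875767878765777688687678778877676558766454777784568776587877676877656875777676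
  ∷ 0x77667767477846767776866687777788777784775657867757688664688656676686776578777877887446688565868777676877678768877766886676776777777776886878787777886767578678567878647687767776778667786748676777864767777787787787768668768877668787676687777676767676877877766878666877646767778777886677487778666886466787877668668767677777777676665867556566667566767767787
  ∷ 0x86778578868777667778575566877466657676677777877686777787573777577777757577877887777778756847477666677875537787465757876776877777877875555886767778777777777786778776757776866668667676677757877877687757576877776777687575776767777877777757577766787737577878768886767677776777867778785657786765757577678787676567775758676578766778777757775767787667775776878
  ∷ 0x77776748666778877776777568677876856777774767785674866668577777567657874767577678857767886767676667777777676667777756676787777665587774646777763566675767766667777776678764747776777766686767777877766677678375685566777646478773547678777777677777787766567757767686777877768757688857668667557785777655866668677687767476778777668787875767657786877677766676667
  ∷ 0x77688766764768876776775866777586674477765857668776756786766676768677666756787777757667677776886677858755668886687786457778777765666765867674665777667676766676767865677467688766677777876786667687786677558766667766676866576677785756877762675766678675577778767588675656767667667777758667766667767777476776665766657567682456787677677577868686777477646676575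
  ∷ 0x77757677766567666876777577678677576666777757665757775567777767686676775376667777766456778767668778656777757757878676756777557675776756777776677566667657155677766676647687777567757875576746677678765753777767685886777777675665576765767557766767677677777758777676667877766667577778875777567868666777785677777547677678866575676876673556878776785867767676766
  ∷ 0x56777567766485667776877357667676578667566767767656888576765676667776766765777877778455778746266777655767536787768477767775676856677667756664667778776777767667765776665866678566665857678566878667766567677787867776466877786667477778777776784767767636768578867664767875572657867777776767757786676767666887656577577667766885876766855657767667566467766776667
  ∷ 0x76687677486787886756687785637786766685642787876756776766676786766775674677556867778768666876786677775687756846667676777766687777767767666668685786655778767775747877776886667587765774776867777867577677668374775776678666776667766776675777676746747856866777678787676664767677847735767676777667788477877576577677787247576565667756677876657766787666674786777
  ∷ 0x77676766587767777787767777677377766777888875875777787777888678786785576777777877557767777887776757758677776687775768675778768777577767787687587787687787767758877848577477778775578777675587768676777765775776587766776888867777577778875784665777766777788837677768768778768735868765675676578887776877588777777377577677786667575688777867777786547777677786751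
  ∷ 0x77778656787578277677767787864786687876666787678675776665866766867666776677787665866767566877778664757776777667666466876778577677677586878776847777737668376777664667767574677777767688676666766476775675777757787666677766883754777755868677846566677877867857646757876766767668787785778477766876477666567675568666587676777867677456767767776762775677654776787
  ∷ 0x56877776556857765877447777747758777677666756765666666776366477876576667677668767677668387676677687755877776775667676677586876674757767756755666567786676776666657767777775867667766568775567877867676766676687867766757867747657276788665776876664678668668577686556776585784776766666776775667877772663767666877567756667576877756746757746777767758667888776877
  ∷ 0x57566577677777786367477757776755776567666677876663786775767777776867777867677665876787667766776767557676756767686778765767776557777675477576876667566777777678776757478766587677766787767676757767676676875765767677665764755577877787767556767866767876878757857657686677766778567655766777758676758777757667176687776675765775567767757676575566777676673875776
  ∷ 0x66777666657776565658767876666767765777758457767678567666688666777767766756786647877676587765876674867678766576667587777777676574666677687777646777787767786787776676776667766666767865854667778876876666777866867727778886656487486667885686776767667666876558277688567675676577668775476567668765666877676575786767754877775777766767766767758566756777678777675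
  ∷ 0x67666777676877677477668566566887474567867767757676776876667567876677676777777755767776677767776756778776678675767665777767857667756478777887767675766588677787557867776876785886887567687568777657867774863778777776787777766777777838867777546577577776876777877777777777777648377777676686676467767684577677677656766768665464887677665766784676666676775776767
  ∷ 0x66677667778877767778776675874777677677766758747787776667777878757677877487786876576786777777777767678778777777887384788785675775865566777836876775777678778675765757775775756577857755575777757768777775687776577657737775765767588757567877685786857777787777767777777778677777876687886757787777776577776777877667675677677876777686556787687765878676768866768
  ∷ 0x78686576778676875666785778688777767676785756787757768787767588767786776777766877767778687848587777676477687667586684788667676867787776686666767666686747676764667487676786877777678766767674784667477677748786667778678687586777688676767888687787876787876778787686667888878547678777776677676667877787786867566767768777476868587785777767766677677767676877677
  ∷ 0x78867876778765758757765667867476777677777887774867787787777787777768777776887776786877875767877884565878867776787667778676867777764777667588875758676876868877788775887788776858876676877668577877786667778676858768885876788666787866676867877767785888767767667578667768857675768887878758867777868578577875677676788767767777665777777785757665577657677788776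
  ∷ 0x87776877777678777768887767768667566876677688778677787787577875676776767656687857767777676777786575777777788778776867768787778777777777777687777778567688875767677757777757775777787377777767777676777777777777777777587787777675777777587677768777877775786777586875777687777757768786757787677877787677785777755866877777786677667788877776777777786868767677677
  ∷ 0x76868767668788778778777777878777767767788787787776686787777867777777687787667768776784687777787767776787867767787778676788887776866668666866686778687786768877866777646877776666466677778667877677886877876766777468778768776877777687787667777877786777788677767778877776688877767867878887766777767678778677786776767787847678667778787676767786867667778676788
  ∷ 0x67776777778776877766777766787887766778776757766676767777776867667567886877676787878877777775777677866677867878787887776785578887677775757768887788667668777767667777675786687778667766687766777768777677876788887778777677767776788786688677788786776676685778877786758877776867577787778778887767668757565767875668776677876677887767866787667877777877877688778
  ∷ 0x58777777786778768785788577777588887767778777866787777877767677777778775577787878677777875867875778775577777887577777577787887777877768776675777786777776777877777787858775777767777777778677788777566676777876677877577776676768777767786777877655778767687767777587666787777877778777767578777787787777778787787687767776767786865777775887767777877665877576877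
  ∷ 0x68786678788768886777787778786788577687676686766767865667667855678777677876878876846766867688676888878887677877677585867775678766487885666678856678767778867766668877787677776788666778688777677868677777777777877678778676788684667686777767776766878776887786678666787668766466777876688876777887776777787776865688876667686767686887876788868677766688776677787
  ∷ 0x77776687767778676867874767866576786565778746567778867777677777886676777677687777688687678677778687786766688866777667767787785776785877778665677887667786677767777786777677577768765777776887787787867776777774787887577677678587777767787767766877577866678786787877776776677878877876777768874667777777777668768565667677445678675677777678868577777565876777777
  ∷ 0x78658777576756776766777576777877667775776767777867687665788765777775687677777766777557787656767776767877767858767767885565887777778777877767676878777876677577666777758776877877768658777737767776775766876788786787767577767786777676687778777787776775777777767777676787735677877877786788586767665775365876767677767677586787776767676768667677557675676877777
  ∷ 0x77777688767676766678666676767577766777766687776585887877674867667777646477778878768778765857578766777776647677576766867677778866776766664777676768667786767877778767648675777777756577767867778876588666676876877776787664677678786767787768666655676626477767657775758768767676777667785767677866666476787778677667766667665667775687666666766757676777876887777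
  ∷ 0x67777758767777778665667567776775767768775776786765875758467677676746875877668777747766777676577768767676567776787765687877777754477773637687754677664777877758687667668675758877766757577877776777675777777476776477776757577684657767686777667667777777677767757687677777858668777866777577667674777766775777577678657376687767778787774867668677866777756766667
  ∷ 0x66777757775677775777674776867687763376874747578665767775677777867577757767776767867757767687786677768664677776577675367877766676775766778585776677557766677777877866577577778867577886775777677778785768667676777677577767477576676867877663776777578775668867677577586767677766677877747576676757766778577767776756667657683565776777578668777777777377656785674
  ∷ 0x78767776857677577887766477778566486777777867754766766477776777777776686487768766775566767857677787747777767667778767645778656574676667876677777677777766266667776775658676688667866866685637767577876642867857574877768778766776677664678667777878768767688767768775776777755777676767764688677777776768676686766657766668775666687787774666767777774768877767877
  ∷ 0x65766678775576777767767467758787678557675766866565877667776787777867856776686778767366678656376777766878645876677377667876776865777577867755676677676767776776756777666777668676554767767465777677765666686787776775375767777666568767687777875757776726658467777753758766463768878768677677667775567676676878767676677776657784765777844767676756675577776877766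
  ∷ 0x86577587577788777765778876546675676686733676785866786677775776775666575776646758887767575776677767676677747757556767686676778766677777557767776677564777876674657767677777568676774675777778677756686767777465776685777577677777676775576777785656637767775668777777567755857768758744767567677576777567776677666678677157485676777647686775748777676575765875788
  ∷ []

rowAt : List ℕ → ℕ → ℕ
rowAt []       _       = 0
rowAt (r ∷ _)  zero    = r
rowAt (_ ∷ rs) (suc i) = rowAt rs i

-- The exhaustive checks below run on ℕ × ℕ, where arithmetic is builtin, rather than on unary Fin.
distᴺ : ℕ × ℕ → ℕ
distᴺ (i , j) = (rowAt distanceRows i / 16 ^ j) {{m^n≢0 16 j}} % 16

dist : G → ℕ
dist = distᴺ ∘ toℕ²

Sᴺ : List (ℕ × ℕ)
Sᴺ = (25 , 50) ∷ (19 , 200) ∷ (43 , 41) ∷ (1 , 338) ∷ (22 , 0) ∷ []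

toℕ²-Sᴸ : map toℕ² Sᴸ ≡ Sᴺ
toℕ²-Sᴸ = refl

Everywhere : (ℕ × ℕ → Set) → Set
Everywhere P = ∀ {i} → i < 44 → ∀ {j} → j < 353 → P (i , j)

everywhere? : ∀ {P} → Decidable P → Dec (Everywhere P)
everywhere? P? = allUpTo? (λ i → allUpTo? (λ j → P? (i , j)) 353) 44

everywhere⇒∀ : ∀ {P} → Everywhere P → ∀ p → P (toℕ² p)
everywhere⇒∀ holds (x , y) = holds (toℕ<n x) (toℕ<n y)

-- The label d of p is a separate argument so that it is evaluated once per vertex, not once per generator.
ShortEdgesFrom : ℕ × ℕ → ℕ → Set
ShortEdgesFrom p d = All (λ s → distᴺ (p ∙ s) ≤ suc d) Sᴺ

DescentFrom : ℕ × ℕ → ℕ → Set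
DescentFrom p d = p ≡ (0 , 0) ⊎ Any (λ s → suc (distᴺ (p ∙ s)) ≡ d) Sᴺ

short-edges : Everywhere (λ p → ShortEdgesFrom p (distᴺ p))
short-edges = from-yes (everywhere? (λ p → shortEdges? p (distᴺ p)))
  where
  shortEdges? : ∀ p d → Dec (ShortEdgesFrom p d)
  shortEdges? p d = all? (λ s → distᴺ (p ∙ s) ≤? suc d) Sᴺ

descent : Everywhere (λ p → DescentFrom p (distᴺ p))
descent = from-yes (everywhere? (λ p → descent? p (distᴺ p)))
  where
  descent? : ∀ p d → Dec (DescentFrom p d)
  descent? p d = ≡-dec _≟_ _≟_ p (0 , 0) ⊎-dec any? (λ s → suc (distᴺ (p ∙ s)) ≟ d) Sᴺ

distᴺ-≤8 : Everywhere (λ p → distᴺ p ≤ 8)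
distᴺ-≤8 = from-yes (everywhere? (λ p → distᴺ p ≤? 8))

dist-edgeLipschitz : EdgeLipschitz dist
dist-edgeLipschitz a _ (s , s∈S , refl) =
  subst (λ q → distᴺ q ≤ suc (dist a)) (sym (toℕ²-· a s))
    (All.lookup (everywhere⇒∀ short-edges a) (subst (toℕ² s ∈_) toℕ²-Sᴸ (∈-map⁺ toℕ² (S⇒∈Sᴸ s∈S))))

descentFrom⇒descends : ∀ a → DescentFrom (toℕ² a) (dist a) → a ≡ e ⊎ ∃ λ b → Adj a b × suc (dist b) ≡ dist a
descentFrom⇒descends a (inj₁ a≡0)   = inj₁ (toℕ²-injective a≡0)
descentFrom⇒descends a (inj₂ lower) = inj₂ (lower-neighbour (find (map⁻ (subst (Any _) (sym toℕ²-Sᴸ) lower))))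
  where
  lower-neighbour : ∃ (λ s → s ∈ Sᴸ × suc (distᴺ (toℕ² a ∙ toℕ² s)) ≡ dist a) → ∃ λ b → Adj a b × suc (dist b) ≡ dist a
  lower-neighbour (s , s∈Sᴸ , 1+fas≡fa) = a · s , (s , ∈Sᴸ⇒S s∈Sᴸ , refl) , trans (cong (suc ∘ distᴺ) (toℕ²-· a s)) 1+fas≡fa

dist-descends : DescendsTo dist e
dist-descends a = descentFrom⇒descends a (everywhere⇒∀ descent a)

dist-e : dist e ≡ 0
dist-e = refl

y₀ : G
y₀ = mk 16 326

dist-y₀ : dist y₀ ≡ 8
dist-y₀ = refl

mainTheorem4 : HasExactly 5 S × (∀ s → S s → ¬ (s ≡ e)) × HasExactly 15532 (λ _ → ⊤) × Connected × Regular 5 × HasDiameter 8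
mainTheorem4 =
  S-has-5 , e∉S , G-has-15532 , (λ x y → _ , walk x y) , cayley-regular S-has-5 ,
  (λ x y → _ , everywhere⇒∀ distᴺ-≤8 (y \\ x) , walk x y) , e , y₀ , y₀-far
  where
  walk : ∀ x y → Walk x y (dist (y \\ x))
  walk = walk-between dist dist-e dist-descends
  y₀-far : ∀ k → Walk e y₀ k → 8 ≤ k
  y₀-far k w = subst₂ (λ d d₀ → d ≤ d₀ + k) dist-y₀ dist-e (walk-length-≥ dist dist-edgeLipschitz w)
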